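{- Let $G_S=(S,N,E_S)$ be a bipartite graph with no isolated vertices, let $\gamma=|N|$, and let $\delta=\frac1\gamma\sum_{v\in N}\deg(v,S)$. Then there is a subset $S'\subseteq S$ with $|\Gamma^1_S(S')|\geq\gamma/(9\log(2\delta))$.
   Context: Logarithms are base 2. $\deg(v,S)$ is the number of neighbors of $v$ in $S$. For $S'\subseteq S$, $\Gamma^1_S(S')$ is the set of vertices outside $S$ (i.e. in $N$) that have exactly one neighbor in $S'$. -}

module Defs where

open import Data.Bool using (Bool; true; false)
open import Data.Nat using (ℕ; _≡ᵇ_)
open import Data.Fin using (Fin)
open import Data.Fin.Subset using (Subset; _∩_; ∣_∣; ⊤)
open import Data.Vec using (tabulate)
open import Data.Vec.Functional using () renaming (foldr to vfoldr)
open import Data.Nat using (_+_)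

-- A bipartite graph G_S = (S, N, E_S) with S = Fin s, N = Fin n,
-- given by its biadjacency relation E u v (u ∈ S, v ∈ N).
BipGraph : ℕ → ℕ → Set
BipGraph s n = Fin s → Fin n → Bool

nbrs : ∀ {s n} → BipGraph s n → Fin n → Subset s
nbrs E v = tabulate (λ u → E u v)

deg : ∀ {s n} → BipGraph s n → Fin n → Subset s → ℕ
deg E v T = ∣ T ∩ nbrs E v ∣

Γ¹ : ∀ {s n} → BipGraph s n → Subset s → Subset n
Γ¹ E S' = tabulate (λ v → deg E v S' ≡ᵇ 1)

totalDeg : ∀ {s n} → BipGraph s n → ℕ
totalDeg {n = n} E = vfoldr (λ d acc → d + acc) 0 (λ v → deg E v ⊤)

-- Let d v be the degree of v ∈ N, ℓ v = ⌊log₂ d v⌋, and let j be the most frequent value of ℓ,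
-- taken a times. Counting ordered pairs (v, w) by the larger scale gives n² ≤ 2a Σ (ℓ v + 1).
-- If every u ∈ S is chosen independently with probability 1/(3·2^j), a vertex of scale j has
-- exactly one chosen neighbour with probability at least 2/9, so some S' has 9 |Γ¹(S')| ≥ 2a.
-- Hence n² ≤ 9k Σ log₂ (2 d v) with k = |Γ¹(S')|, and AM-GM bounds Π (2 d v) by (2D/n)^n,
-- which is 2^n n^(9k) ≤ (2D)^(9k) after exponentiating.
{-# OPTIONS --safe #-}
module Submission where

open import Defs
open import Data.Bool as Bool using (Bool; true; false)
open import Data.Nat
open import Data.Nat.Properties
open import Data.Nat.Tactic.RingSolver using (solve-∀)
open import Data.Fin using (Fin; zero; suc)
open import Data.Fin.Subset using (Subset; ∣_∣; ⊤; _∩_)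
open import Data.Fin.Subset.Properties using (∩-identityˡ)
open import Data.Vec using ([]; _∷_; tabulate)
open import Data.Vec.Functional using (Vector; foldr)
open import Data.List using (allFin)
open import Data.List.Relation.Unary.All as All using ()
open import Data.List.Membership.Propositional.Properties using (∈-allFin)
open import Data.List.Extrema.Nat using (argmax; f[xs]≤f[argmax])
open import Data.Product using (∃; ∃-syntax; ∃₂; _×_; _,_; proj₁; proj₂)
open import Data.Sum using (_⊎_; inj₁; inj₂; [_,_]′)
open import Data.Unit using (tt)
open import Function using (_∘_)
open import Relation.Binary.PropositionalEquality
open import Relation.Nullary using (yes; no)
open import Algebra.Properties.Semiring.Sum +-*-semiring
  using (sum; sum-cong-≗; ∑-distrib-+; ∑-comm; *-distribˡ-sum; *-distribʳ-sum)

indicator : Bool → ℕ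
indicator true  = 1
indicator false = 0

product : ∀ {n} → Vector ℕ n → ℕ
product = foldr _*_ 1

sum-mono-≤ : ∀ {n} {f g : Vector ℕ n} → (∀ i → f i ≤ g i) → sum f ≤ sum g
sum-mono-≤ {zero}  f≤g = z≤n
sum-mono-≤ {suc n} f≤g = +-mono-≤ (f≤g zero) (sum-mono-≤ (f≤g ∘ suc))

product-mono-≤ : ∀ {n} {f g : Vector ℕ n} → (∀ i → f i ≤ g i) → product f ≤ product g
product-mono-≤ {zero}  f≤g = ≤-refl
product-mono-≤ {suc n} f≤g = *-mono-≤ (f≤g zero) (product-mono-≤ (f≤g ∘ suc))

sum-const : ∀ n c → sum {n} (λ _ → c) ≡ n * c
sum-const zero    c = refl
sum-const (suc n) c = cong (c +_) (sum-const n c)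

≤-sum : ∀ {n} (f : Vector ℕ n) i → f i ≤ sum f
≤-sum f zero    = m≤m+n _ _
≤-sum f (suc i) = ≤-trans (≤-sum (f ∘ suc) i) (m≤n+m _ (f zero))

^-sum : ∀ {n} b (f : Vector ℕ n) → b ^ sum f ≡ product (λ i → b ^ f i)
^-sum {zero}  b f = refl
^-sum {suc n} b f = trans (^-distribˡ-+-* b (f zero) _) (cong (b ^ f zero *_) (^-sum b (f ∘ suc)))

^-distribʳ-* : ∀ a b k → (a * b) ^ k ≡ a ^ k * b ^ k
^-distribʳ-* a b zero    = refl
^-distribʳ-* a b (suc k) = trans (cong (a * b *_) (^-distribʳ-* a b k)) (regroup a b (a ^ k) (b ^ k))
  where
  regroup : ∀ a b x y → a * b * (x * y) ≡ a * x * (b * y)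
  regroup = solve-∀

product-^ : ∀ {n} (f : Vector ℕ n) k → product (λ i → f i ^ k) ≡ product f ^ k
product-^ {zero}  f k = sym (^-zeroˡ k)
product-^ {suc n} f k =
  trans (cong (f zero ^ k *_) (product-^ (f ∘ suc) k)) (sym (^-distribʳ-* (f zero) _ k))

^-cancelʳ-≤ : ∀ n {x y} → x ^ suc n ≤ y ^ suc n → x ≤ y
^-cancelʳ-≤ n xⁿ≤yⁿ = ≮⇒≥ (λ y<x → <⇒≱ (^-monoˡ-< (suc n) y<x) xⁿ≤yⁿ)

∣tabulate∣≡∑indicator : ∀ {n} (p : Fin n → Bool) → ∣ tabulate p ∣ ≡ sum (indicator ∘ p)
∣tabulate∣≡∑indicator {zero}  p = refl
∣tabulate∣≡∑indicator {suc n} p with p zero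
... | true  = cong suc (∣tabulate∣≡∑indicator (p ∘ suc))
... | false = ∣tabulate∣≡∑indicator (p ∘ suc)

∑indicator≡0⊎∃ : ∀ {n} (p : Fin n → Bool) → sum (indicator ∘ p) ≡ 0 ⊎ ∃[ i ] p i ≡ true
∑indicator≡0⊎∃ {zero}  p = inj₁ refl
∑indicator≡0⊎∃ {suc n} p with p zero in p₀ | ∑indicator≡0⊎∃ (p ∘ suc)
... | true  | _             = inj₂ (zero , p₀)
... | false | inj₁ ∑≡0      = inj₁ ∑≡0
... | false | inj₂ (i , pᵢ) = inj₂ (suc i , pᵢ)

-- Σ_{R ⊆ Fin s} q ^ (s - ∣R∣) · F R: up to the factor (q + 1) ^ s, the expectation of F
-- over a random subset containing each element independently with probability 1/(q + 1).
weightedSum : ∀ {s} → ℕ → (Subset s → ℕ) → ℕ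
weightedSum {zero}  q F = F []
weightedSum {suc s} q F = weightedSum q (F ∘ (true ∷_)) + q * weightedSum q (F ∘ (false ∷_))

weightedSum-cong : ∀ {s} q {F G : Subset s → ℕ} → (∀ R → F R ≡ G R) → weightedSum q F ≡ weightedSum q G
weightedSum-cong {zero}  q F≡G = F≡G []
weightedSum-cong {suc s} q F≡G =
  cong₂ (λ x y → x + q * y) (weightedSum-cong q (F≡G ∘ (true ∷_))) (weightedSum-cong q (F≡G ∘ (false ∷_)))

weightedSum-zero : ∀ {s} q → weightedSum {s} q (λ _ → 0) ≡ 0
weightedSum-zero {zero}  q = refl
weightedSum-zero {suc s} q rewrite weightedSum-zero {s} q = *-zeroʳ q

weightedSum-+ : ∀ {s} q (F G : Subset s → ℕ) →
  weightedSum q (λ R → F R + G R) ≡ weightedSum q F + weightedSum q G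
weightedSum-+ {zero}  q F G = refl
weightedSum-+ {suc s} q F G =
  trans (cong₂ (λ x y → x + q * y) (weightedSum-+ q F₁ G₁) (weightedSum-+ q F₀ G₀))
        (regroup q (weightedSum q F₁) (weightedSum q G₁) (weightedSum q F₀) (weightedSum q G₀))
  where
  F₁ G₁ F₀ G₀ : Subset s → ℕ
  F₁ = F ∘ (true ∷_)
  G₁ = G ∘ (true ∷_)
  F₀ = F ∘ (false ∷_)
  G₀ = G ∘ (false ∷_)
  regroup : ∀ q a b c d → a + b + q * (c + d) ≡ a + q * c + (b + q * d)
  regroup = solve-∀

weightedSum-sum : ∀ {s n} q (F : Fin n → Subset s → ℕ) →
  weightedSum q (λ R → sum (λ v → F v R)) ≡ sum (λ v → weightedSum q (F v))
weightedSum-sum {s} {zero}  q F = weightedSum-zero {s} q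
weightedSum-sum {s} {suc n} q F =
  trans (weightedSum-+ q (F zero) (λ R → sum (λ v → F (suc v) R)))
        (cong (weightedSum q (F zero) +_) (weightedSum-sum q (F ∘ suc)))

weightedSum-≤-max : ∀ {s} q (F : Subset s → ℕ) → ∃[ R ] weightedSum q F ≤ suc q ^ s * F R
weightedSum-≤-max {zero}  q F = [] , ≤-reflexive (sym (+-identityʳ (F [])))
weightedSum-≤-max {suc s} q F
  with weightedSum-≤-max q (F ∘ (true ∷_)) | weightedSum-≤-max q (F ∘ (false ∷_))
... | T₁ , bound₁ | T₂ , bound₂ = larger (≤-total (F (true ∷ T₁)) (F (false ∷ T₂)))
  where
  combine : ∀ {M} → F (true ∷ T₁) ≤ M → F (false ∷ T₂) ≤ M → weightedSum q F ≤ suc q ^ suc s * M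
  combine {M} F₁≤M F₂≤M = begin
    weightedSum q (F ∘ (true ∷_)) + q * weightedSum q (F ∘ (false ∷_))
      ≤⟨ +-mono-≤ bound₁ (*-monoʳ-≤ q bound₂) ⟩
    suc q ^ s * F (true ∷ T₁) + q * (suc q ^ s * F (false ∷ T₂))
      ≤⟨ +-mono-≤ (*-monoʳ-≤ (suc q ^ s) F₁≤M) (*-monoʳ-≤ q (*-monoʳ-≤ (suc q ^ s) F₂≤M)) ⟩
    suc q ^ s * M + q * (suc q ^ s * M)
      ≡⟨ sym (*-assoc (suc q) (suc q ^ s) M) ⟩
    suc q ^ suc s * M ∎
    where open ≤-Reasoning
  larger : F (true ∷ T₁) ≤ F (false ∷ T₂) ⊎ F (false ∷ T₂) ≤ F (true ∷ T₁) →
           ∃[ R ] weightedSum q F ≤ suc q ^ suc s * F R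
  larger (inj₁ F₁≤F₂) = false ∷ T₂ , combine F₁≤F₂ ≤-refl
  larger (inj₂ F₂≤F₁) = true ∷ T₁ , combine ≤-refl F₂≤F₁

missed hitOnce : ∀ {s} → Subset s → Subset s → ℕ
missed  X R = indicator (∣ R ∩ X ∣ ≡ᵇ 0)
hitOnce X R = indicator (∣ R ∩ X ∣ ≡ᵇ 1)

weightedSum-missed : ∀ {s} q (X : Subset s) →
  weightedSum q (missed X) * suc q ^ ∣ X ∣ ≡ q ^ ∣ X ∣ * suc q ^ s
weightedSum-missed q [] = refl
weightedSum-missed {suc s} q (false ∷ X) = begin
  suc q * W₀ * suc q ^ ∣ X ∣         ≡⟨ *-assoc (suc q) W₀ (suc q ^ ∣ X ∣) ⟩
  suc q * (W₀ * suc q ^ ∣ X ∣)       ≡⟨ cong (suc q *_) (weightedSum-missed q X) ⟩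
  suc q * (q ^ ∣ X ∣ * suc q ^ s)    ≡⟨ regroup (suc q) (q ^ ∣ X ∣) (suc q ^ s) ⟩
  q ^ ∣ X ∣ * (suc q * suc q ^ s)    ∎
  where
  open ≡-Reasoning
  W₀ = weightedSum {s} q (missed X)
  regroup : ∀ m x y → m * (x * y) ≡ x * (m * y)
  regroup = solve-∀
weightedSum-missed {suc s} q (true ∷ X) = begin
  (weightedSum {s} q (λ _ → 0) + q * W₀) * (suc q * suc q ^ ∣ X ∣)
    ≡⟨ cong (λ z → (z + q * W₀) * (suc q * suc q ^ ∣ X ∣)) (weightedSum-zero {s} q) ⟩
  q * W₀ * (suc q * suc q ^ ∣ X ∣)       ≡⟨ regroup (suc q) q W₀ (suc q ^ ∣ X ∣) ⟩
  suc q * q * (W₀ * suc q ^ ∣ X ∣)       ≡⟨ cong (suc q * q *_) (weightedSum-missed q X) ⟩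
  suc q * q * (q ^ ∣ X ∣ * suc q ^ s)    ≡⟨ regroup′ (suc q) q (q ^ ∣ X ∣) (suc q ^ s) ⟩
  q * q ^ ∣ X ∣ * (suc q * suc q ^ s)    ∎
  where
  open ≡-Reasoning
  W₀ = weightedSum {s} q (missed X)
  regroup : ∀ m q w p → q * w * (m * p) ≡ m * q * (w * p)
  regroup = solve-∀
  regroup′ : ∀ m q x y → m * q * (x * y) ≡ q * x * (m * y)
  regroup′ = solve-∀

weightedSum-hitOnce : ∀ {s} q (X : Subset s) →
  weightedSum q (hitOnce X) * suc q ^ ∣ X ∣ * q ≡ ∣ X ∣ * q ^ ∣ X ∣ * suc q ^ s
weightedSum-hitOnce q [] = refl
weightedSum-hitOnce {suc s} q (false ∷ X) = begin
  suc q * W₁ * suc q ^ ∣ X ∣ * q               ≡⟨ regroup (suc q) W₁ (suc q ^ ∣ X ∣) q ⟩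
  suc q * (W₁ * suc q ^ ∣ X ∣ * q)             ≡⟨ cong (suc q *_) (weightedSum-hitOnce q X) ⟩
  suc q * (∣ X ∣ * q ^ ∣ X ∣ * suc q ^ s)      ≡⟨ regroup′ (suc q) (∣ X ∣ * q ^ ∣ X ∣) (suc q ^ s) ⟩
  ∣ X ∣ * q ^ ∣ X ∣ * (suc q * suc q ^ s)      ∎
  where
  open ≡-Reasoning
  W₁ = weightedSum {s} q (hitOnce X)
  regroup : ∀ m w p q → m * w * p * q ≡ m * (w * p * q)
  regroup = solve-∀
  regroup′ : ∀ m x y → m * (x * y) ≡ x * (m * y)
  regroup′ = solve-∀
weightedSum-hitOnce {suc s} q (true ∷ X) = begin
  (W₀ + q * W₁) * (suc q * suc q ^ t) * q
    ≡⟨ regroup (suc q) q W₀ W₁ (suc q ^ t) ⟩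
  suc q * q * (W₀ * suc q ^ t) + suc q * q * (W₁ * suc q ^ t * q)
    ≡⟨ cong₂ (λ x y → suc q * q * x + suc q * q * y) (weightedSum-missed q X) (weightedSum-hitOnce q X) ⟩
  suc q * q * (q ^ t * suc q ^ s) + suc q * q * (t * q ^ t * suc q ^ s)
    ≡⟨ regroup′ (suc q) q t (q ^ t) (suc q ^ s) ⟩
  suc t * (q * q ^ t) * (suc q * suc q ^ s)
    ∎
  where
  open ≡-Reasoning
  t  = ∣ X ∣
  W₀ = weightedSum {s} q (missed X)
  W₁ = weightedSum {s} q (hitOnce X)
  regroup : ∀ m q w₀ w₁ p → (w₀ + q * w₁) * (m * p) * q ≡ m * q * (w₀ * p) + m * q * (w₁ * p * q)
  regroup = solve-∀
  regroup′ : ∀ m q t x y → m * q * (x * y) + m * q * (t * x * y) ≡ suc t * (q * x) * (m * y)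
  regroup′ = solve-∀

2*m*n≤m*m+n*n : ∀ m n → 2 * m * n ≤ m * m + n * n
2*m*n≤m*m+n*n m n = [ ordered , flipped ]′ (≤-total m n)
  where
  identity : ∀ a k → 2 * a * (a + k) + k * k ≡ a * a + (a + k) * (a + k)
  identity = solve-∀
  swap : ∀ a b → 2 * a * b ≡ 2 * b * a
  swap = solve-∀
  ordered : ∀ {a b} → a ≤ b → 2 * a * b ≤ a * a + b * b
  ordered {a} a≤b with m≤n⇒∃[o]m+o≡n a≤b
  ... | k , refl = ≤-trans (m≤m+n _ (k * k)) (≤-reflexive (identity a k))
  flipped : n ≤ m → 2 * m * n ≤ m * m + n * n
  flipped n≤m = subst₂ _≤_ (swap n m) (+-comm (n * n) (m * m)) (ordered n≤m)

weighted-amgm : ∀ k a b → suc k * b * a ^ k ≤ b ^ suc k + k * a ^ suc k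
weighted-amgm zero a b = ≤-reflexive (base a b)
  where
  base : ∀ a b → 1 * b * 1 ≡ b * 1 + 0 * (a * 1)
  base = solve-∀
weighted-amgm (suc k) a b = +-cancelʳ-≤ Z _ _ (begin
  suc (suc k) * b * (a * P) + Z                    ≡⟨ regroup k a b P ⟩
  b * (suc k * b * P) + suc k * P * (2 * a * b)    ≤⟨ +-mono-≤ (*-monoʳ-≤ b (weighted-amgm k a b))
                                                                (*-monoʳ-≤ (suc k * P) (2*m*n≤m*m+n*n a b)) ⟩
  b * (b * R + k * (a * P)) + suc k * P * (a * a + b * b)
                                                   ≡⟨ regroup′ k a b P R ⟩
  b * (b * R) + suc k * (a * (a * P)) + Z          ∎)
  where
  open ≤-Reasoning
  P = a ^ k
  R = b ^ k
  Z = suc k * b * b * P + k * (a * P) * b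
  regroup : ∀ k a b P → suc (suc k) * b * (a * P) + (suc k * b * b * P + k * (a * P) * b)
                        ≡ b * (suc k * b * P) + suc k * P * (2 * a * b)
  regroup = solve-∀
  regroup′ : ∀ k a b P R → b * (b * R + k * (a * P)) + suc k * P * (a * a + b * b)
                           ≡ b * (b * R) + suc k * (a * (a * P)) + (suc k * b * b * P + k * (a * P) * b)
  regroup′ = solve-∀

window-decomposition : ∀ {T e} → T ≤ suc e → suc e < 2 * T → ∃₂ λ r p → T ≡ suc (r + p) × e ≡ r + p + r
window-decomposition {T} {e} T≤t t<2T with m≤n⇒∃[o]m+o≡n T≤t | m≤n⇒∃[o]m+o≡n t<2T
... | r , T+r≡t | p , t+1+p≡2T = r , p , T≡ , e≡
  where
  open ≡-Reasoning
  shift : ∀ T r p → suc (T + r) + p ≡ T + suc (r + p)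
  shift = solve-∀
  T≡ : T ≡ suc (r + p)
  T≡ = +-cancelˡ-≡ T T (suc (r + p)) (begin
    T + T            ≡⟨ cong (T +_) (sym (+-identityʳ T)) ⟩
    2 * T            ≡⟨ sym t+1+p≡2T ⟩
    suc (suc e) + p  ≡⟨ cong (λ z → suc z + p) (sym T+r≡t) ⟩
    suc (T + r) + p  ≡⟨ shift T r p ⟩
    T + suc (r + p)  ∎)
  e≡ : e ≡ r + p + r
  e≡ = suc-injective (trans (sym T+r≡t) (cong (_+ r) T≡))

-- With m = q + 1 = 3T and t = e + 1 this says 9 t (m - t) + 2 m ≥ 2 m², and indeed
-- 9 t (m - t) - 2 m² = 9 (t - T) (2T - t) ≥ 0.
quadratic-window : ∀ {q T e} → suc q ≡ 3 * T → T ≤ suc e → suc e < 2 * T →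
  2 * suc q * q + 9 * suc e * e * suc q ≤ 9 * suc e * suc e * q
quadratic-window {q} m≡3T T≤t t<2T with window-decomposition T≤t t<2T
... | r , p , refl , refl with suc-injective (trans m≡3T (*-suc 3 (r + p)))
...   | refl = ≤-trans (m≤m+n _ _) (≤-reflexive (identity r p))
  where
  identity : ∀ r p → let q = 2 + 3 * (r + p) ; e = r + p + r in
    2 * suc q * q + 9 * suc e * e * suc q + (9 * r * suc p + 2 * suc q) ≡ 9 * suc e * suc e * q
  identity = solve-∀

-- The probability t · (1/m) · (1 - 1/m) ^ (t - 1) that exactly one of t elements is chosen is at
-- least 2/9 when m = q + 1 = 3T and T ≤ t < 2T, cleared of denominators.
hitOnce-odds : ∀ {q T t} → suc q ≡ 3 * T → T ≤ t → t < 2 * T → 2 * suc q ^ t * q ≤ 9 * t * q ^ t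
hitOnce-odds {t = zero} _ z≤n ()
hitOnce-odds {q} {t = suc e} m≡3T T≤t t<2T = +-cancelʳ-≤ (9 * t * e * (m * P)) _ _ (begin
  2 * (m * P) * q + 9 * t * e * (m * P)  ≡⟨ factor m q t e P ⟩
  (2 * m * q + 9 * t * e * m) * P        ≤⟨ *-monoˡ-≤ P (quadratic-window m≡3T T≤t t<2T) ⟩
  9 * t * t * q * P                      ≡⟨ regroup t q P ⟩
  9 * t * (t * q * P)                    ≤⟨ *-monoʳ-≤ (9 * t) (weighted-amgm e m q) ⟩
  9 * t * (q * Q + e * (m * P))          ≡⟨ expand m q t e P Q ⟩
  9 * t * (q * Q) + 9 * t * e * (m * P)  ∎)
  where
  open ≤-Reasoning
  m = suc q
  t = suc e
  P = m ^ e
  Q = q ^ e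
  factor : ∀ m q t e P → 2 * (m * P) * q + 9 * t * e * (m * P) ≡ (2 * m * q + 9 * t * e * m) * P
  factor = solve-∀
  regroup : ∀ t q P → 9 * t * t * q * P ≡ 9 * t * (t * q * P)
  regroup = solve-∀
  expand : ∀ m q t e P Q → 9 * t * (q * Q + e * (m * P)) ≡ 9 * t * (q * Q) + 9 * t * e * (m * P)
  expand = solve-∀

hitOnce-likely : ∀ {s q T} (X : Subset s) → suc q ≡ 3 * T → T ≤ ∣ X ∣ → ∣ X ∣ < 2 * T →
  2 * suc q ^ s ≤ 9 * weightedSum q (hitOnce X)
hitOnce-likely {s} {q} {T} X m≡3T T≤t t<2T = *-cancelʳ-≤ (2 * m ^ s) (9 * W) c {{c≢0}} (begin
  2 * m ^ s * c              ≡⟨ regroup (m ^ s) (m ^ t) q ⟩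
  m ^ s * (2 * m ^ t * q)    ≤⟨ *-monoʳ-≤ (m ^ s) (hitOnce-odds m≡3T T≤t t<2T) ⟩
  m ^ s * (9 * t * q ^ t)    ≡⟨ regroup′ (m ^ s) t (q ^ t) ⟩
  9 * (t * q ^ t * m ^ s)    ≡⟨ cong (9 *_) (sym (weightedSum-hitOnce q X)) ⟩
  9 * (W * m ^ t * q)        ≡⟨ regroup″ W (m ^ t) q ⟩
  9 * W * c                  ∎)
  where
  open ≤-Reasoning
  m = suc q
  t = ∣ X ∣
  W = weightedSum q (hitOnce X)
  c = m ^ t * q
  0<T : 0 < T
  0<T = n≢0⇒n>0 (λ { refl → <-irrefl refl (≤-<-trans T≤t t<2T) })
  0<q : 0 < q
  0<q = ≤-trans (s≤s z≤n) (≤-pred (≤-trans (*-monoʳ-≤ 3 0<T) (≤-reflexive (sym m≡3T))))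
  c≢0 : NonZero c
  c≢0 = m*n≢0 (m ^ t) q {{m^n≢0 m t}} {{>-nonZero 0<q}}
  regroup : ∀ M P q → 2 * M * (P * q) ≡ M * (2 * P * q)
  regroup = solve-∀
  regroup′ : ∀ M t Q → M * (9 * t * Q) ≡ 9 * (t * Q * M)
  regroup′ = solve-∀
  regroup″ : ∀ W P q → 9 * (W * P * q) ≡ 9 * W * (P * q)
  regroup″ = solve-∀

Γ¹-first-moment : ∀ {s n} (E : BipGraph s n) (C : Fin n → Bool) {q T} → suc q ≡ 3 * T →
  (∀ v → C v ≡ true → T ≤ ∣ nbrs E v ∣ × ∣ nbrs E v ∣ < 2 * T) →
  ∃[ S' ] 2 * sum (indicator ∘ C) ≤ 9 * ∣ Γ¹ E S' ∣
Γ¹-first-moment {s} E C {q} m≡3T inWindow =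
  S' , *-cancelˡ-≤ (m ^ s) {{m^n≢0 m s}} (begin
    m ^ s * (2 * sum (indicator ∘ C))
      ≡⟨ trans (regroup (m ^ s) (sum (indicator ∘ C))) (*-distribˡ-sum (2 * m ^ s) (indicator ∘ C)) ⟩
    sum (λ v → 2 * m ^ s * indicator (C v))
      ≤⟨ sum-mono-≤ perVertex ⟩
    sum (λ v → 9 * weightedSum q (hitOnce (nbrs E v)))
      ≡⟨ sym (*-distribˡ-sum 9 (λ v → weightedSum q (hitOnce (nbrs E v)))) ⟩
    9 * sum (λ v → weightedSum q (hitOnce (nbrs E v)))
      ≡⟨ cong (9 *_) (sym ∑-by-vertex) ⟩
    9 * weightedSum q (λ R → ∣ Γ¹ E R ∣)
      ≤⟨ *-monoʳ-≤ 9 S'-above-average ⟩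
    9 * (m ^ s * ∣ Γ¹ E S' ∣)
      ≡⟨ regroup′ (m ^ s) ∣ Γ¹ E S' ∣ ⟩
    m ^ s * (9 * ∣ Γ¹ E S' ∣) ∎)
  where
  open ≤-Reasoning
  m = suc q
  S'-with-bound = weightedSum-≤-max q (λ R → ∣ Γ¹ E R ∣)
  S' = proj₁ S'-with-bound
  S'-above-average = proj₂ S'-with-bound
  ∣Γ¹∣≡∑hitOnce : ∀ R → ∣ Γ¹ E R ∣ ≡ sum (λ v → hitOnce (nbrs E v) R)
  ∣Γ¹∣≡∑hitOnce R = ∣tabulate∣≡∑indicator (λ v → deg E v R ≡ᵇ 1)
  ∑-by-vertex : weightedSum q (λ R → ∣ Γ¹ E R ∣) ≡ sum (λ v → weightedSum q (hitOnce (nbrs E v)))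
  ∑-by-vertex = trans (weightedSum-cong q ∣Γ¹∣≡∑hitOnce) (weightedSum-sum q (hitOnce ∘ nbrs E))
  perVertex : ∀ v → 2 * m ^ s * indicator (C v) ≤ 9 * weightedSum q (hitOnce (nbrs E v))
  perVertex v with C v in Cv
  ... | false = ≤-trans (≤-reflexive (*-zeroʳ (2 * m ^ s))) z≤n
  ... | true  = ≤-trans (≤-reflexive (*-identityʳ (2 * m ^ s)))
                        (hitOnce-likely (nbrs E v) m≡3T (proj₁ (inWindow v Cv)) (proj₂ (inWindow v Cv)))
  regroup : ∀ M x → M * (2 * x) ≡ 2 * M * x
  regroup = solve-∀
  regroup′ : ∀ M k → 9 * (M * k) ≡ M * (9 * k)
  regroup′ = solve-∀

dyadic-scale : ∀ {t} → 0 < t → ∃[ j ] 2 ^ j ≤ t × t < 2 ^ suc j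
dyadic-scale {suc zero}    _ = 0 , ≤-refl , s≤s (s≤s z≤n)
dyadic-scale {suc (suc d)} _ with dyadic-scale {suc d} (s≤s z≤n)
... | j , 2ʲ≤t , t<2ʲ⁺¹ with suc (suc d) <? 2 ^ suc j
...   | yes t+1<2ʲ⁺¹ = j , m≤n⇒m≤1+n 2ʲ≤t , t+1<2ʲ⁺¹
...   | no  t+1≮2ʲ⁺¹ = suc j , ≤-reflexive (sym t+1≡2ʲ⁺¹) ,
                       subst (_< 2 ^ suc (suc j)) (sym t+1≡2ʲ⁺¹) (^-monoʳ-< 2 (s≤s (s≤s z≤n)) (n<1+n (suc j)))
  where
  t+1≡2ʲ⁺¹ : suc (suc d) ≡ 2 ^ suc j
  t+1≡2ʲ⁺¹ = ≤-antisym t<2ʲ⁺¹ (≮⇒≥ t+1≮2ʲ⁺¹)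

≡ᵇ≡true⇒≡ : ∀ {m n} → (m ≡ᵇ n) ≡ true → m ≡ n
≡ᵇ≡true⇒≡ {m} {n} eq = ≡ᵇ⇒≡ m n (subst Bool.T (sym eq) tt)

classSize : ∀ {n} → (Fin n → ℕ) → ℕ → ℕ
classSize ℓ x = sum (λ v → indicator (ℓ v ≡ᵇ x))

indicator-<ᵇ-suc : ∀ y x → indicator (y <ᵇ suc x) ≡ indicator (y <ᵇ x) + indicator (y ≡ᵇ x)
indicator-<ᵇ-suc zero    zero    = refl
indicator-<ᵇ-suc zero    (suc x) = refl
indicator-<ᵇ-suc (suc y) zero    = refl
indicator-<ᵇ-suc (suc y) (suc x) = indicator-<ᵇ-suc y x

indicator-<ᵇ-suc-total : ∀ x y → 1 ≤ indicator (x <ᵇ suc y) + indicator (y <ᵇ suc x)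
indicator-<ᵇ-suc-total zero    y       = s≤s z≤n
indicator-<ᵇ-suc-total (suc x) zero    = s≤s z≤n
indicator-<ᵇ-suc-total (suc x) (suc y) = indicator-<ᵇ-suc-total x y

countBelow-≤ : ∀ {n} (ℓ : Fin n → ℕ) {a} → (∀ x → classSize ℓ x ≤ a) →
  ∀ x → sum (λ v → indicator (ℓ v <ᵇ x)) ≤ x * a
countBelow-≤ {n} ℓ small zero = ≤-reflexive (trans (sum-const n 0) (*-zeroʳ n))
countBelow-≤ ℓ {a} small (suc x) = begin
  sum (λ v → indicator (ℓ v <ᵇ suc x))
    ≡⟨ sum-cong-≗ (λ v → indicator-<ᵇ-suc (ℓ v) x) ⟩
  sum (λ v → indicator (ℓ v <ᵇ x) + indicator (ℓ v ≡ᵇ x))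
    ≡⟨ ∑-distrib-+ (λ v → indicator (ℓ v <ᵇ x)) (λ v → indicator (ℓ v ≡ᵇ x)) ⟩
  sum (λ v → indicator (ℓ v <ᵇ x)) + classSize ℓ x
    ≤⟨ +-mono-≤ (countBelow-≤ ℓ small x) (small x) ⟩
  x * a + a
    ≡⟨ +-comm (x * a) a ⟩
  suc x * a ∎
  where open ≤-Reasoning

pair-count : ∀ {n} (ℓ : Fin n → ℕ) {a} → (∀ x → classSize ℓ x ≤ a) → n * n ≤ 2 * a * sum (suc ∘ ℓ)
pair-count {n} ℓ {a} small = begin
  n * n
    ≡⟨ sym all-pairs ⟩
  sum {n} (λ _ → sum {n} (λ _ → 1))
    ≤⟨ sum-mono-≤ (λ v → sum-mono-≤ (λ w → indicator-<ᵇ-suc-total (ℓ w) (ℓ v))) ⟩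
  sum (λ v → sum (λ w → below w v + below v w))
    ≡⟨ sum-cong-≗ (λ v → ∑-distrib-+ (λ w → below w v) (λ w → below v w)) ⟩
  sum (λ v → sum (λ w → below w v) + sum (λ w → below v w))
    ≡⟨ ∑-distrib-+ (λ v → sum (λ w → below w v)) (λ v → sum (λ w → below v w)) ⟩
  B + sum (λ v → sum (λ w → below v w))
    ≡⟨ cong (B +_) (∑-comm (λ v w → below v w)) ⟩
  B + B
    ≤⟨ +-mono-≤ B≤ B≤ ⟩
  sum (suc ∘ ℓ) * a + sum (suc ∘ ℓ) * a
    ≡⟨ regroup (sum (suc ∘ ℓ)) a ⟩
  2 * a * sum (suc ∘ ℓ) ∎
  where
  open ≤-Reasoning
  all-pairs : sum {n} (λ _ → sum {n} (λ _ → 1)) ≡ n * n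
  all-pairs = trans (sum-cong-≗ {n} (λ _ → sum-const n 1)) (trans (sum-const n (n * 1)) (cong (n *_) (*-identityʳ n)))
  below : Fin n → Fin n → ℕ
  below w v = indicator (ℓ w <ᵇ suc (ℓ v))
  B = sum (λ v → sum (λ w → below w v))
  B≤ : B ≤ sum (suc ∘ ℓ) * a
  B≤ = ≤-trans (sum-mono-≤ (λ v → countBelow-≤ ℓ small (suc (ℓ v))))
               (≤-reflexive (sym (*-distribʳ-sum a (suc ∘ ℓ))))
  regroup : ∀ F a → F * a + F * a ≡ 2 * a * F
  regroup = solve-∀

classSize-≤ : ∀ {n} (ℓ : Fin n → ℕ) {a} → (∀ w → classSize ℓ (ℓ w) ≤ a) → ∀ x → classSize ℓ x ≤ a
classSize-≤ ℓ small x with ∑indicator≡0⊎∃ (λ v → ℓ v ≡ᵇ x)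
... | inj₁ empty       = ≤-trans (≤-reflexive empty) z≤n
... | inj₂ (w , ℓw≡ᵇx) = subst (λ y → classSize ℓ y ≤ _) (≡ᵇ≡true⇒≡ ℓw≡ᵇx) (small w)

most-frequent-class : ∀ {n} (ℓ : Fin (suc n) → ℕ) → ∃[ j ] ∀ x → classSize ℓ x ≤ classSize ℓ j
most-frequent-class {n} ℓ = ℓ v* , classSize-≤ ℓ (λ w → All.lookup v*-max (∈-allFin w))
  where
  v* = argmax (classSize ℓ ∘ ℓ) zero (allFin (suc n))
  v*-max = f[xs]≤f[argmax] {f = classSize ℓ ∘ ℓ} zero (allFin (suc n))

-- Weighted AM-GM with a = (n + 1) S and b = n (S + y).
amgm-step : ∀ n S y → suc n * suc n ^ n * S ^ n * y ≤ n ^ n * (S + y) ^ suc n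
amgm-step zero S y = ≤-trans (≤-reflexive (regroup y)) (≤-trans (m≤n+m y S) (≤-reflexive (regroup′ S y)))
  where
  regroup : ∀ y → 1 * 1 * 1 * y ≡ y
  regroup = solve-∀
  regroup′ : ∀ S y → S + y ≡ 1 * ((S + y) * 1)
  regroup′ = solve-∀
amgm-step n@(suc _) S y = *-cancelˡ-≤ n (+-cancelʳ-≤ Z _ _ (begin
  n * (suc n * A * P * y) + Z                            ≡⟨ regroup n S y A P ⟩
  suc n * (n * (S + y)) * (A * P)                        ≡⟨ cong (suc n * (n * (S + y)) *_) (sym (^-distribʳ-* (suc n) S n)) ⟩
  suc n * (n * (S + y)) * (suc n * S) ^ n                ≤⟨ weighted-amgm n (suc n * S) (n * (S + y)) ⟩
  n * (S + y) * (n * (S + y)) ^ n + n * (suc n * S * (suc n * S) ^ n)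
                                                         ≡⟨ cong₂ (λ u v → n * (S + y) * u + n * (suc n * S * v))
                                                                  (^-distribʳ-* n (S + y) n) (^-distribʳ-* (suc n) S n) ⟩
  n * (S + y) * (N * Q) + n * (suc n * S * (A * P))       ≡⟨ regroup′ n S y A P N Q ⟩
  n * (N * ((S + y) * Q)) + Z                            ∎))
  where
  open ≤-Reasoning
  A = suc n ^ n
  P = S ^ n
  N = n ^ n
  Q = (S + y) ^ n
  Z = n * (suc n * S * (A * P))
  regroup : ∀ n S y A P → n * (suc n * A * P * y) + n * (suc n * S * (A * P)) ≡ suc n * (n * (S + y)) * (A * P)
  regroup = solve-∀
  regroup′ : ∀ n S y A P N Q → n * (S + y) * (N * Q) + n * (suc n * S * (A * P))
                               ≡ n * (N * ((S + y) * Q)) + n * (suc n * S * (A * P))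
  regroup′ = solve-∀

amgm : ∀ n (x : Vector ℕ n) → n ^ n * product x ≤ sum x ^ n
amgm zero    x = ≤-refl
amgm (suc n) x = *-cancelˡ-≤ N {{nⁿ≢0 n}} (begin
  N * (suc n * A * (y * P))  ≡⟨ regroup N (suc n) A y P ⟩
  suc n * A * y * (N * P)    ≤⟨ *-monoʳ-≤ (suc n * A * y) (amgm n (x ∘ suc)) ⟩
  suc n * A * y * S ^ n      ≡⟨ regroup′ (suc n) A y (S ^ n) ⟩
  suc n * A * S ^ n * y      ≤⟨ amgm-step n S y ⟩
  N * (S + y) ^ suc n        ≡⟨ cong (λ z → N * z ^ suc n) (+-comm S y) ⟩
  N * (y + S) ^ suc n        ∎)
  where
  open ≤-Reasoning
  N = n ^ n
  A = suc n ^ n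
  y = x zero
  P = product (x ∘ suc)
  S = sum (x ∘ suc)
  nⁿ≢0 : ∀ n → NonZero (n ^ n)
  nⁿ≢0 zero    = _
  nⁿ≢0 (suc n) = m^n≢0 (suc n) (suc n)
  regroup : ∀ N m A y P → N * (m * A * (y * P)) ≡ m * A * y * (N * P)
  regroup = solve-∀
  regroup′ : ∀ m A y s → m * A * y * s ≡ m * A * s * y
  regroup′ = solve-∀

2^N≤∏g^K : ∀ {n} N K (f g : Vector ℕ n) → N ≤ K * sum f → (∀ v → 2 ^ f v ≤ g v) → 2 ^ N ≤ product g ^ K
2^N≤∏g^K N K f g N≤Kf 2^f≤g = begin
  2 ^ N                           ≤⟨ ^-monoʳ-≤ 2 N≤Kf ⟩
  2 ^ (K * sum f)                 ≡⟨ cong (2 ^_) (*-distribˡ-sum K f) ⟩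
  2 ^ sum (λ v → K * f v)         ≡⟨ ^-sum 2 (λ v → K * f v) ⟩
  product (λ v → 2 ^ (K * f v))   ≤⟨ product-mono-≤ termwise ⟩
  product (λ v → g v ^ K)         ≡⟨ product-^ g K ⟩
  product g ^ K                   ∎
  where
  open ≤-Reasoning
  termwise : ∀ v → 2 ^ (K * f v) ≤ g v ^ K
  termwise v = begin
    2 ^ (K * f v)    ≡⟨ cong (2 ^_) (*-comm K (f v)) ⟩
    2 ^ (f v * K)    ≡⟨ sym (^-*-assoc 2 (f v) K) ⟩
    (2 ^ f v) ^ K    ≤⟨ ^-monoˡ-≤ K (2^f≤g v) ⟩
    g v ^ K          ∎

2^n*n^K≤∑g^K : ∀ n₀ K (g : Vector ℕ (suc n₀)) → let n = suc n₀ in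
  2 ^ (n * n) ≤ product g ^ K → 2 ^ n * n ^ K ≤ sum g ^ K
2^n*n^K≤∑g^K n₀ K g 2^n²≤∏g^K = ^-cancelʳ-≤ n₀ (begin
  (2 ^ n * n ^ K) ^ n            ≡⟨ ^-distribʳ-* (2 ^ n) (n ^ K) n ⟩
  (2 ^ n) ^ n * (n ^ K) ^ n      ≡⟨ cong₂ _*_ (^-*-assoc 2 n n) (swap-exponents n K n) ⟩
  2 ^ (n * n) * (n ^ n) ^ K      ≤⟨ *-monoˡ-≤ ((n ^ n) ^ K) 2^n²≤∏g^K ⟩
  product g ^ K * (n ^ n) ^ K    ≡⟨ sym (^-distribʳ-* (product g) (n ^ n) K) ⟩
  (product g * n ^ n) ^ K        ≡⟨ cong (_^ K) (*-comm (product g) (n ^ n)) ⟩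
  (n ^ n * product g) ^ K        ≤⟨ ^-monoˡ-≤ K (amgm n g) ⟩
  (sum g ^ n) ^ K                ≡⟨ swap-exponents (sum g) n K ⟩
  (sum g ^ K) ^ n                ∎)
  where
  open ≤-Reasoning
  n = suc n₀
  swap-exponents : ∀ a i k → (a ^ i) ^ k ≡ (a ^ k) ^ i
  swap-exponents a i k = trans (^-*-assoc a i k) (trans (cong (a ^_) (*-comm i k)) (sym (^-*-assoc a k i)))

∣tabulate∣-positive : ∀ {n} (p : Fin n → Bool) {i} → p i ≡ true → 0 < ∣ tabulate p ∣
∣tabulate∣-positive p {i} pᵢ = begin
  1                    ≡⟨ cong indicator (sym pᵢ) ⟩
  indicator (p i)      ≤⟨ ≤-sum (indicator ∘ p) i ⟩
  sum (indicator ∘ p)  ≡⟨ sym (∣tabulate∣≡∑indicator p) ⟩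
  ∣ tabulate p ∣       ∎
  where open ≤-Reasoning

totalDeg≡∑∣nbrs∣ : ∀ {s n} (E : BipGraph s n) → totalDeg E ≡ sum (λ v → ∣ nbrs E v ∣)
totalDeg≡∑∣nbrs∣ E = sum-cong-≗ (λ v → cong ∣_∣ (∩-identityˡ (nbrs E v)))

-- Isolated vertices of S are never counted.
lemmaA13 : (s n : ℕ) (E : BipGraph s n)
    → (∀ (u : Fin s) → ∃[ v ] E u v ≡ true)
    → (∀ (v : Fin n) → ∃[ u ] E u v ≡ true)
    → ∃[ S' ] (2 ^ n * n ^ (9 * ∣ Γ¹ E S' ∣) ≤ (2 * totalDeg E) ^ (9 * ∣ Γ¹ E S' ∣))
lemmaA13 s zero E _ _ = ⊤ , ≤-refl
lemmaA13 s n@(suc n₀) E _ hasNeighbour =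
  S' , subst (λ D → 2 ^ n * n ^ K ≤ D ^ K) ∑g≡2D
             (2^n*n^K≤∑g^K n₀ K g (2^N≤∏g^K (n * n) K (suc ∘ ℓ) g n²≤K∑ 2^ℓ≤g))
  where
  d : Fin n → ℕ
  d v = ∣ nbrs E v ∣
  scale : ∀ v → ∃[ j ] 2 ^ j ≤ d v × d v < 2 ^ suc j
  scale v = dyadic-scale (∣tabulate∣-positive (λ u → E u v) (proj₂ (hasNeighbour v)))
  ℓ : Fin n → ℕ
  ℓ v = proj₁ (scale v)
  j = proj₁ (most-frequent-class ℓ)
  inClass : ∀ v → (ℓ v ≡ᵇ j) ≡ true → 2 ^ j ≤ d v × d v < 2 * 2 ^ j
  inClass v ℓv≡j = subst (λ i → 2 ^ i ≤ d v × d v < 2 ^ suc i) (≡ᵇ≡true⇒≡ {ℓ v} ℓv≡j) (proj₂ (scale v))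
  m≡3·2ʲ : suc (pred (3 * 2 ^ j)) ≡ 3 * 2 ^ j
  m≡3·2ʲ = suc-pred (3 * 2 ^ j) {{m*n≢0 3 (2 ^ j) {{_}} {{m^n≢0 2 j}}}}
  hits = Γ¹-first-moment E (λ v → ℓ v ≡ᵇ j) m≡3·2ʲ inClass
  S' = proj₁ hits
  K = 9 * ∣ Γ¹ E S' ∣
  n²≤K∑ : n * n ≤ K * sum (suc ∘ ℓ)
  n²≤K∑ = ≤-trans (pair-count ℓ (proj₂ (most-frequent-class ℓ))) (*-monoˡ-≤ (sum (suc ∘ ℓ)) (proj₂ hits))
  g : Fin n → ℕ
  g v = 2 * d v
  2^ℓ≤g : ∀ v → 2 ^ suc (ℓ v) ≤ g v
  2^ℓ≤g v = *-monoʳ-≤ 2 (proj₁ (proj₂ (scale v)))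
  ∑g≡2D : sum g ≡ 2 * totalDeg E
  ∑g≡2D = sym (trans (cong (2 *_) (totalDeg≡∑∣nbrs∣ E)) (*-distribˡ-sum 2 d))
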